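{- For every $n\in\mathbb{N}$, $\mathrm{avg}_1(P_{n+1}) - \mathrm{avg}_1(P_n) \le \frac{2}{3}$, where $P_n$ denotes the path on $n$ vertices.
   Context: Let $G=(V,E)$ be a finite connected graph with a fixed root $v_0$. A $1$-Lipschitz mapping of $G$ is a map $f:V\to\mathbb{Z}$ with $f(v_0)=0$ and $|f(u)-f(v)|\le 1$ for every edge $uv$; the set of these is $\mathcal{L}_1(G)$. The range of $f$ is $\mathrm{rng}(f)=|\{f(v):v\in V\}|$, and $\mathrm{avg}_1(G)=\frac{\sum_{f\in\mathcal{L}_1(G)}\mathrm{rng}(f)}{|\mathcal{L}_1(G)|}$ (independent of the choice of root). -}

module Defs where

open import Data.Bool using (Bool; true; false; _∧_; _∨_; if_then_else_)
open import Data.Nat as ℕ using (ℕ; zero; suc)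
open import Data.Integer as ℤ using (ℤ; +_; ∣_∣)
open import Data.Fin using (Fin; toℕ)
open import Data.List using (List; []; _∷_; map; concatMap; length; filter; upTo; allFin; deduplicate)
open import Data.Bool.ListAction using (and)
open import Data.Nat.ListAction using (sum)
open import Data.Vec using (Vec; lookup; toList)
import Data.Vec as Vec
open import Data.Rational as ℚ using (ℚ; _/_)
open import Relation.Nullary.Decidable using (T?)

record Graph : Set where
  field
    n    : ℕ
    adj  : Fin n → Fin n → Bool
    root : Fin n
open Graph public

Map : Graph → Set
Map G = Vec ℤ (n G)

isLipschitz₁ : (G : Graph) → Map G → Bool
isLipschitz₁ G f =
  (∣ lookup f (root G) ∣ ℕ.≡ᵇ 0) ∧
  and (map (λ u → and (map (λ v → if adj G u v then ∣ lookup f u ℤ.- lookup f v ∣ ℕ.≤ᵇ 1 else true)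
                           (allFin (n G))))
            (allFin (n G)))

allVecs : {A : Set} → List A → (k : ℕ) → List (Vec A k)
allVecs xs zero    = Vec.[] ∷ []
allVecs xs (suc k) = concatMap (λ x → map (x Vec.∷_) (allVecs xs k)) xs

window : ℕ → List ℤ
window m = map (λ i → + i ℤ.- + m) (upTo (suc (2 ℕ.* m)))

-- For a connected graph on n vertices every
-- such map takes values in [-n, n] (distance to the root is < n), so enumerating
-- maps into that window and filtering by the definition gives exactly L₁(G).
L₁ : (G : Graph) → List (Map G)
L₁ G = filter (λ f → T? (isLipschitz₁ G f)) (allVecs (window (n G)) (n G))

rng : {G : Graph} → Map G → ℕ
rng f = length (deduplicate ℤ._≟_ (toList f))

-- avg₁(G) = (Σ_{f ∈ L₁(G)} rng f) / |L₁(G)|   (set to 0 if L₁(G) were empty, which never happens)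
avg₁ : Graph → ℚ
avg₁ G with length (L₁ G)
... | zero  = ℚ.0ℚ
... | suc c = (+ sum (map (rng {G}) (L₁ G))) / suc c

-- The path P_{k+1} on k+1 vertices 0,1,…,k (edges i ~ i+1), rooted at vertex 0.
-- (The paper's P_n for n ≥ 1; P_0 is empty and cannot be rooted.)
P[1+_] : ℕ → Graph
P[1+ k ] = record
  { n    = suc k
  ; adj  = λ i j → (suc (toℕ i) ℕ.≡ᵇ toℕ j) ∨ (suc (toℕ j) ℕ.≡ᵇ toℕ i)
  ; root = Fin.zero
  }
  where import Data.Fin as Fin

{-# OPTIONS --safe #-}
module Submission where

-- A 1-Lipschitz map of the path P_{k+1}, rooted at an end, is a lazy walk of k steps in {-1, 0, 1}
-- starting at 0, so there are 3^k of them.  A walk of k+1 steps is 0 followed by a k-step walk from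
-- -1, 0 or 1.  Prepending 0 to a walk that starts at 0 keeps its range, prepending it to a walk from
-- ±1 raises the range by at most one, and by translation the walks from ±1 have the same total range
-- R as those from 0.  So the total range grows from R to at most 3R + 2·3^k while the number of maps
-- triples, and the average grows by at most 2/3.

open import Defs
open import Data.Nat using (suc)
open import Data.Integer using (+_)
open import Data.Rational using (_-_; _≤_; _/_)

open import Function using (_∘_; _⇔_; mk⇔; Equivalence; Injective)
open import Data.Bool using (Bool; true; false; T; if_then_else_)
import Data.Bool.Properties as 𝔹P
open import Data.Bool.ListAction using (all)
open import Data.Unit using (⊤; tt)
open import Data.Product using (_×_; _,_; proj₁; proj₂)
open import Data.Fin using (Fin) renaming (zero to fzero; suc to fsuc)
open import Data.Nat as ℕ using (ℕ; zero; z≤n; s≤s; _^_)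
import Data.Nat.Properties as ℕP
import Data.Nat.Tactic.RingSolver as ℕ-Solver
open import Data.Nat.ListAction using (sum)
import Data.Nat.ListAction.Properties as ℕLP
open import Data.Integer as ℤ using (ℤ; -[1+_]; ∣_∣; 0ℤ; 1ℤ; -1ℤ)
import Data.Integer.Properties as ℤP
import Data.Integer.Tactic.RingSolver as ℤ-Solver
open import Algebra.Properties.AbelianGroup ℤP.+-0-abelianGroup
  using (∙-cancelˡ; ∙-cancelʳ; //-rightDividesʳ; xyx⁻¹≈y)
import Data.Rational as ℚ
open import Data.Rational.Properties using (toℚᵘ-cancel-≤; toℚᵘ-homo-+; toℚᵘ-homo‿-; toℚᵘ-fromℚᵘ)
open import Data.Rational.Unnormalised as ℚᵘ using (ℚᵘ; mkℚᵘ; *≤*; _≃_)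
import Data.Rational.Unnormalised.Properties as ℚᵘP
open import Data.Vec as Vec using (Vec; []; _∷_; head; lookup; toList)
import Data.Vec.Properties as VecP
import Data.Vec.Relation.Unary.All as VecAll
open import Data.List using (List; []; _∷_; _++_; [_]; map; concatMap; length; filter; deduplicate; allFin)
import Data.List.Properties as ListP
open import Data.List.Membership.Propositional using (_∈_; find; lose)
open import Data.List.Membership.Propositional.Properties
  using (∈-map⁺; ∈-map⁻; ∈-concatMap⁺; ∈-concatMap⁻; ∈-filter⁺; ∈-filter⁻; ∈-upTo⁺; ∈-allFin)
open import Data.List.Membership.Propositional.Properties.WithK using (unique∧set⇒bag)
open import Data.List.Relation.Unary.Any using (here; there)
import Data.List.Relation.Unary.All as All
import Data.List.Relation.Unary.All.Properties as AllP
import Data.List.Relation.Unary.AllPairs as AllPairs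
import Data.List.Relation.Unary.AllPairs.Properties as AllPairsP
open import Data.List.Relation.Unary.Unique.Propositional using (Unique)
import Data.List.Relation.Unary.Unique.Propositional.Properties as UniqueP
open import Data.List.Relation.Binary.Disjoint.Propositional using (Disjoint)
open import Data.List.Relation.Binary.BagAndSetEquality using (∼bag⇒↭)
open import Data.List.Relation.Binary.Permutation.Propositional using (_↭_)
import Data.List.Relation.Binary.Permutation.Propositional.Properties as ↭P
open import Relation.Nullary using (¬?; does)
open import Relation.Nullary.Decidable using (T?)
open import Relation.Unary using (Pred; Decidable; _≐_)
open import Relation.Binary.Definitions using (DecidableEquality)
open import Relation.Binary.PropositionalEquality hiding ([_])

module _ {A B : Set} where

  filter-map : ∀ {p} {P : Pred B p} (P? : Decidable P) (f : A → B) (xs : List A) →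
               filter P? (map f xs) ≡ map f (filter (P? ∘ f) xs)
  filter-map P? f []       = refl
  filter-map P? f (x ∷ xs) with does (P? (f x))
  ... | true  = cong (f x ∷_) (filter-map P? f xs)
  ... | false = filter-map P? f xs

  deduplicate-map : (_≟ᴬ_ : DecidableEquality A) (_≟ᴮ_ : DecidableEquality B) {f : A → B} →
                    Injective _≡_ _≡_ f → ∀ xs →
                    deduplicate _≟ᴮ_ (map f xs) ≡ map f (deduplicate _≟ᴬ_ xs)
  deduplicate-map _≟ᴬ_ _≟ᴮ_ f-inj [] = refl
  deduplicate-map _≟ᴬ_ _≟ᴮ_ {f} f-inj (x ∷ xs) = cong (f x ∷_) (begin
    filter (¬? ∘ (f x ≟ᴮ_)) (deduplicate _≟ᴮ_ (map f xs)) ≡⟨ cong (filter _) (deduplicate-map _≟ᴬ_ _≟ᴮ_ f-inj xs) ⟩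
    filter (¬? ∘ (f x ≟ᴮ_)) (map f D)                     ≡⟨ filter-map _ f D ⟩
    map f (filter (¬? ∘ (f x ≟ᴮ_) ∘ f) D)                 ≡⟨ cong (map f) (ListP.filter-≐ _ _ same-test D) ⟩
    map f (filter (¬? ∘ (x ≟ᴬ_)) D)                       ∎)
    where
    open ≡-Reasoning
    D : List A
    D = deduplicate _≟ᴬ_ xs
    same-test : (λ y → f x ≢ f y) ≐ (λ y → x ≢ y)
    same-test = (λ fx≢fy x≡y → fx≢fy (cong f x≡y)) , (λ x≢y fx≡fy → x≢y (f-inj fx≡fy))

  unique-concatMap : (f : A → List B) {xs : List A} → Unique xs → (∀ x → Unique (f x)) →
                     (∀ {x y} → x ≢ y → Disjoint (f x) (f y)) → Unique (concatMap f xs)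
  unique-concatMap f {xs} xs! f! f-disjoint =
    UniqueP.concat⁺ (AllP.map⁺ (All.universal f! xs)) (AllPairsP.map⁺ (AllPairs.map f-disjoint xs!))

  length-concatMap : (f : A → List B) (xs : List A) → length (concatMap f xs) ≡ sum (map (length ∘ f) xs)
  length-concatMap f []       = refl
  length-concatMap f (x ∷ xs) = trans (ListP.length-++ (f x)) (cong (length (f x) ℕ.+_) (length-concatMap f xs))

  sum-map-concatMap : (g : B → ℕ) (f : A → List B) (xs : List A) →
                      sum (map g (concatMap f xs)) ≡ sum (map (λ x → sum (map g (f x))) xs)
  sum-map-concatMap g f []       = refl
  sum-map-concatMap g f (x ∷ xs) = begin
    sum (map g (f x ++ concatMap f xs))                 ≡⟨ cong sum (ListP.map-++ g (f x) _) ⟩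
    sum (map g (f x) ++ map g (concatMap f xs))         ≡⟨ ℕLP.sum-++ (map g (f x)) _ ⟩
    sum (map g (f x)) ℕ.+ sum (map g (concatMap f xs))  ≡⟨ cong (sum (map g (f x)) ℕ.+_) (sum-map-concatMap g f xs) ⟩
    sum (map (λ x → sum (map g (f x))) (x ∷ xs))        ∎
    where open ≡-Reasoning

deduplicate-∷-∷ : ∀ {A : Set} (_≟_ : DecidableEquality A) x xs →
                  deduplicate _≟_ (x ∷ x ∷ xs) ≡ deduplicate _≟_ (x ∷ xs)
deduplicate-∷-∷ _≟_ x xs =
  cong (x ∷_) (trans (ListP.filter-reject x≢? (λ x≢x → x≢x refl)) (ListP.filter-idem x≢? (deduplicate _≟_ xs)))
  where
  x≢? : Decidable (x ≢_)
  x≢? = ¬? ∘ (x ≟_)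

T-if-then-else-true : ∀ b {c} → T (if b then c else true) ⇔ (T b → T c)
T-if-then-else-true true  = mk⇔ (λ t _ → t) (λ h → h tt)
T-if-then-else-true false = mk⇔ (λ _ ()) (λ _ → tt)

T-all-allFin : ∀ {n} (p : Fin n → Bool) → T (all p (allFin n)) ⇔ (∀ i → T (p i))
T-all-allFin p =
  mk⇔ (λ t i → All.lookup (AllP.all⁺ p _ t) (∈-allFin i)) (λ h → AllP.all⁻ p (All.universal h (allFin _)))

x+[y-x]≡y : ∀ x y → x ℤ.+ (y ℤ.- x) ≡ y
x+[y-x]≡y = ℤ-Solver.solve-∀

∈-allVecs⁺ : ∀ {A : Set} {xs : List A} {k} {v : Vec A k} → VecAll.All (_∈ xs) v → v ∈ allVecs xs k
∈-allVecs⁺ VecAll.[] = here refl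
∈-allVecs⁺ {xs = xs} {v = x ∷ v} (x∈xs VecAll.∷ v∈xs) =
  ∈-concatMap⁺ (λ y → map (y ∷_) (allVecs xs _)) (lose x∈xs (∈-map⁺ (x ∷_) (∈-allVecs⁺ v∈xs)))

allVecs-unique : ∀ {A : Set} {xs : List A} k → Unique xs → Unique (allVecs xs k)
allVecs-unique zero _ = All.[] AllPairs.∷ AllPairs.[]
allVecs-unique {xs = xs} (suc k) xs! =
  unique-concatMap _ xs! (λ _ → UniqueP.map⁺ VecP.∷-injectiveʳ (allVecs-unique k xs!)) different-heads
  where
  different-heads : ∀ {x y} → x ≢ y → Disjoint (map (x ∷_) (allVecs xs k)) (map (y ∷_) (allVecs xs k))
  different-heads x≢y (p , q) with ∈-map⁻ _ p | ∈-map⁻ _ q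
  ... | _ , _ , refl | _ , _ , eq = x≢y (VecP.∷-injectiveˡ eq)

window-unique : ∀ m → Unique (window m)
window-unique m =
  UniqueP.map⁺ (λ {i} {j} eq → ℤP.+-injective (∙-cancelʳ (ℤ.- + m) (+ i) (+ j) eq)) (UniqueP.upTo⁺ _)

∈-window⁺ : ∀ {m} z → ∣ z ∣ ℕ.≤ m → z ∈ window m
∈-window⁺ {m} (+ j) j≤m = subst (_∈ window m) shift (∈-map⁺ _ (∈-upTo⁺ (s≤s index≤2m)))
  where
  index≤2m : j ℕ.+ m ℕ.≤ 2 ℕ.* m
  index≤2m = subst (j ℕ.+ m ℕ.≤_) (cong (m ℕ.+_) (sym (ℕP.+-identityʳ m))) (ℕP.+-monoˡ-≤ m j≤m)
  shift : + (j ℕ.+ m) ℤ.- + m ≡ + j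
  shift = trans (cong (ℤ._- + m) (ℤP.pos-+ j m)) (//-rightDividesʳ (+ m) (+ j))
∈-window⁺ {m} -[1+ j ] j<m = subst (_∈ window m) shift (∈-map⁺ _ (∈-upTo⁺ (s≤s index≤2m)))
  where
  index≤2m : m ℕ.∸ suc j ℕ.≤ 2 ℕ.* m
  index≤2m = ℕP.≤-trans (ℕP.m∸n≤m m (suc j)) (ℕP.m≤m+n m _)
  shift : + (m ℕ.∸ suc j) ℤ.- + m ≡ -[1+ j ]
  shift = trans (cong (ℤ._- + m) (sym (ℤP.⊖-≥ j<m))) (xyx⁻¹≈y (+ m) -[1+ j ])

Lipschitz : (G : Graph) → Map G → Set
Lipschitz G f = ∀ u v → T (adj G u v) → ∣ lookup f u ℤ.- lookup f v ∣ ℕ.≤ 1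

T-isLipschitz₁ : ∀ G (f : Map G) → T (isLipschitz₁ G f) ⇔ (lookup f (root G) ≡ 0ℤ × Lipschitz G f)
T-isLipschitz₁ G f = mk⇔ test⇒ ⇒test
  where
  open Equivalence
  edge : Fin (n G) → Fin (n G) → Bool
  edge u v = if adj G u v then ∣ lookup f u ℤ.- lookup f v ∣ ℕ.≤ᵇ 1 else true
  T-edges : T (all (λ u → all (edge u) (allFin (n G))) (allFin (n G))) ⇔ (∀ u v → T (edge u v))
  T-edges = mk⇔ (λ t u → to (T-all-allFin (edge u)) (to (T-all-allFin _) t u))
                (λ h → from (T-all-allFin _) (λ u → from (T-all-allFin (edge u)) (h u)))
  test⇒ : T (isLipschitz₁ G f) → lookup f (root G) ≡ 0ℤ × Lipschitz G f
  test⇒ t = let root≡0 , edges = to 𝔹P.T-∧ t in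
    ℤP.∣i∣≡0⇒i≡0 (ℕP.≡ᵇ⇒≡ _ 0 root≡0) ,
    λ u v → ℕP.≤ᵇ⇒≤ _ 1 ∘ to (T-if-then-else-true (adj G u v)) (to T-edges edges u v)
  ⇒test : lookup f (root G) ≡ 0ℤ × Lipschitz G f → T (isLipschitz₁ G f)
  ⇒test (root≡0 , L) = from 𝔹P.T-∧
    (ℕP.≡⇒≡ᵇ _ 0 (cong ∣_∣ root≡0) ,
     from T-edges (λ u v → from (T-if-then-else-true (adj G u v)) (ℕP.≤⇒≤ᵇ ∘ L u v)))

IsWalk : ∀ {k} → Vec ℤ (suc k) → Set
IsWalk (x ∷ [])    = ⊤
IsWalk (x ∷ y ∷ v) = ∣ y ℤ.- x ∣ ℕ.≤ 1 × IsWalk (y ∷ v)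

Lipschitz⇒IsWalk : ∀ {k} (f : Vec ℤ (suc k)) → Lipschitz P[1+ k ] f → IsWalk f
Lipschitz⇒IsWalk (x ∷ [])    _ = tt
Lipschitz⇒IsWalk (x ∷ y ∷ f) L = L (fsuc fzero) fzero tt , Lipschitz⇒IsWalk (y ∷ f) (λ u v → L (fsuc u) (fsuc v))

IsWalk⇒Lipschitz : ∀ {k} (f : Vec ℤ (suc k)) → IsWalk f → Lipschitz P[1+ k ] f
IsWalk⇒Lipschitz (x ∷ [])    _         fzero           fzero           ()
IsWalk⇒Lipschitz (x ∷ y ∷ f) _         fzero           fzero           ()
IsWalk⇒Lipschitz (x ∷ y ∷ f) (y~x , _) fzero           (fsuc fzero)    _  = subst (ℕ._≤ 1) (ℤP.∣i-j∣≡∣j-i∣ y x) y~x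
IsWalk⇒Lipschitz (x ∷ y ∷ f) _         fzero           (fsuc (fsuc _)) ()
IsWalk⇒Lipschitz (x ∷ y ∷ f) (y~x , _) (fsuc fzero)    fzero           _  = y~x
IsWalk⇒Lipschitz (x ∷ y ∷ f) _         (fsuc (fsuc _)) fzero           ()
IsWalk⇒Lipschitz (x ∷ y ∷ f) (_ , w)   (fsuc u)        (fsuc v)        uv = IsWalk⇒Lipschitz (y ∷ f) w u v uv

IsWalk⇒bounded : ∀ {k} (v : Vec ℤ (suc k)) → IsWalk v → VecAll.All (λ x → ∣ x ∣ ℕ.≤ ∣ head v ∣ ℕ.+ k) v
IsWalk⇒bounded (x ∷ []) _ = ℕP.≤-reflexive (sym (ℕP.+-identityʳ _)) VecAll.∷ VecAll.[]
IsWalk⇒bounded {suc k} (x ∷ y ∷ v) (y~x , w) =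
  ℕP.m≤m+n _ _ VecAll.∷ VecAll.map (λ b → ℕP.≤-trans b ∣y∣+k≤∣x∣+1+k) (IsWalk⇒bounded (y ∷ v) w)
  where
  ∣y∣≤∣x∣+1 : ∣ y ∣ ℕ.≤ ∣ x ∣ ℕ.+ 1
  ∣y∣≤∣x∣+1 = begin
    ∣ y ∣                  ≡⟨ cong ∣_∣ (x+[y-x]≡y x y) ⟨
    ∣ x ℤ.+ (y ℤ.- x) ∣    ≤⟨ ℤP.∣i+j∣≤∣i∣+∣j∣ x (y ℤ.- x) ⟩
    ∣ x ∣ ℕ.+ ∣ y ℤ.- x ∣  ≤⟨ ℕP.+-monoʳ-≤ ∣ x ∣ y~x ⟩
    ∣ x ∣ ℕ.+ 1            ∎
    where open ℕP.≤-Reasoning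
  ∣y∣+k≤∣x∣+1+k : ∣ y ∣ ℕ.+ k ℕ.≤ ∣ x ∣ ℕ.+ suc k
  ∣y∣+k≤∣x∣+1+k = ℕP.≤-trans (ℕP.+-monoˡ-≤ k ∣y∣≤∣x∣+1) (ℕP.≤-reflexive (ℕP.+-assoc ∣ x ∣ 1 k))

unitSteps : List ℤ
unitSteps = -1ℤ ∷ 0ℤ ∷ 1ℤ ∷ []

∈-unitSteps⁺ : ∀ {d} → ∣ d ∣ ℕ.≤ 1 → d ∈ unitSteps
∈-unitSteps⁺ { -[1+ 0 ]}     _        = here refl
∈-unitSteps⁺ {+ 0}           _        = there (here refl)
∈-unitSteps⁺ {+ 1}           _        = there (there (here refl))
∈-unitSteps⁺ {+ suc (suc _)} (s≤s ())
∈-unitSteps⁺ { -[1+ suc _ ]} (s≤s ())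

∈-unitSteps⁻ : ∀ {d} → d ∈ unitSteps → ∣ d ∣ ℕ.≤ 1
∈-unitSteps⁻ (here refl)                 = ℕP.≤-refl
∈-unitSteps⁻ (there (here refl))         = z≤n
∈-unitSteps⁻ (there (there (here refl))) = ℕP.≤-refl

unitSteps-unique : Unique unitSteps
unitSteps-unique =
  ((λ ()) All.∷ (λ ()) All.∷ All.[]) AllPairs.∷ ((λ ()) All.∷ All.[]) AllPairs.∷ All.[] AllPairs.∷ AllPairs.[]

walks : (k : ℕ) → ℤ → List (Vec ℤ (suc k))
walksWithFirstStep : (k : ℕ) → ℤ → ℤ → List (Vec ℤ (suc (suc k)))

walks zero    a = [ a ∷ [] ]
walks (suc k) a = concatMap (walksWithFirstStep k a) unitSteps

walksWithFirstStep k a d = map (a ∷_) (walks k (a ℤ.+ d))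

∈-walks⁻ : ∀ k {a} {v : Vec ℤ (suc k)} → v ∈ walks k a → head v ≡ a × IsWalk v
∈-walks⁻ zero (here refl) = refl , tt
∈-walks⁻ (suc k) {a} v∈ with find (∈-concatMap⁻ (walksWithFirstStep k a) {xs = unitSteps} v∈)
... | d , d∈ , v∈′ with ∈-map⁻ (a ∷_) v∈′
... | y ∷ w , w∈ , refl with ∈-walks⁻ k w∈
... | refl , w-walk = refl , subst (λ i → ∣ i ∣ ℕ.≤ 1) (sym (xyx⁻¹≈y a d)) (∈-unitSteps⁻ d∈) , w-walk

∈-walks⁺ : ∀ k {v : Vec ℤ (suc k)} → IsWalk v → v ∈ walks k (head v)
∈-walks⁺ zero    {x ∷ []}    _              = here refl
∈-walks⁺ (suc k) {x ∷ y ∷ w} (y~x , w-walk) =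
  ∈-concatMap⁺ (walksWithFirstStep k x) (lose (∈-unitSteps⁺ y~x) (∈-map⁺ (x ∷_) y∷w∈))
  where
  y∷w∈ : y ∷ w ∈ walks k (x ℤ.+ (y ℤ.- x))
  y∷w∈ = subst (λ b → y ∷ w ∈ walks k b) (sym (x+[y-x]≡y x y)) (∈-walks⁺ k w-walk)

walks-unique : ∀ k a → Unique (walks k a)
walks-unique zero    a = All.[] AllPairs.∷ AllPairs.[]
walks-unique (suc k) a = unique-concatMap (walksWithFirstStep k a) unitSteps-unique
  (λ d → UniqueP.map⁺ VecP.∷-injectiveʳ (walks-unique k (a ℤ.+ d))) different-tails
  where
  different-tails : ∀ {d e} → d ≢ e → Disjoint (walksWithFirstStep k a d) (walksWithFirstStep k a e)
  different-tails d≢e (p , q) with ∈-map⁻ _ p | ∈-map⁻ _ q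
  ... | w , w∈ , refl | w′ , w′∈ , eq with VecP.∷-injectiveʳ eq
  ... | refl = d≢e (∙-cancelˡ a _ _ (trans (sym (proj₁ (∈-walks⁻ k w∈))) (proj₁ (∈-walks⁻ k w′∈))))

length-walks : ∀ k a → length (walks k a) ≡ 3 ^ k
length-walks zero    a = refl
length-walks (suc k) a = begin
  length (walks (suc k) a)                               ≡⟨ length-concatMap (walksWithFirstStep k a) unitSteps ⟩
  sum (map (length ∘ walksWithFirstStep k a) unitSteps)  ≡⟨ cong sum (ListP.map-cong length-block unitSteps) ⟩
  3 ^ suc k                                              ∎
  where
  open ≡-Reasoning
  length-block : ∀ d → length (walksWithFirstStep k a d) ≡ 3 ^ k
  length-block d = trans (ListP.length-map (a ∷_) (walks k (a ℤ.+ d))) (length-walks k (a ℤ.+ d))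

walks-translate : ∀ k c a → map (Vec.map (ℤ._+_ c)) (walks k a) ≡ walks k (c ℤ.+ a)
walks-translate zero    c a = refl
walks-translate (suc k) c a = begin
  map τ (concatMap (walksWithFirstStep k a) unitSteps)    ≡⟨ ListP.map-concatMap τ (walksWithFirstStep k a) unitSteps ⟩
  concatMap (map τ ∘ walksWithFirstStep k a) unitSteps    ≡⟨ ListP.concatMap-cong translate-block unitSteps ⟩
  concatMap (walksWithFirstStep k (c ℤ.+ a)) unitSteps    ∎
  where
  open ≡-Reasoning
  τ : ∀ {n} → Vec ℤ n → Vec ℤ n
  τ = Vec.map (ℤ._+_ c)
  translate-block : ∀ d → map τ (walksWithFirstStep k a d) ≡ walksWithFirstStep k (c ℤ.+ a) d
  translate-block d = begin
    map τ (map (a ∷_) (walks k (a ℤ.+ d)))          ≡⟨ ListP.map-∘ (walks k (a ℤ.+ d)) ⟨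
    map (λ w → c ℤ.+ a ∷ τ w) (walks k (a ℤ.+ d))   ≡⟨ ListP.map-∘ (walks k (a ℤ.+ d)) ⟩
    map (c ℤ.+ a ∷_) (map τ (walks k (a ℤ.+ d)))    ≡⟨ cong (map (c ℤ.+ a ∷_)) (walks-translate k c (a ℤ.+ d)) ⟩
    map (c ℤ.+ a ∷_) (walks k (c ℤ.+ (a ℤ.+ d)))    ≡⟨ cong (map (c ℤ.+ a ∷_) ∘ walks k) (ℤP.+-assoc c a d) ⟨
    map (c ℤ.+ a ∷_) (walks k (c ℤ.+ a ℤ.+ d))      ∎

-- rng {G} f unfolds to #values f; #values does not mention the graph.
#values : ∀ {n} → Vec ℤ n → ℕ
#values v = length (deduplicate ℤ._≟_ (toList v))

totalRange : ∀ {n} → List (Vec ℤ n) → ℕ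
totalRange vs = sum (map #values vs)

#values-translate : ∀ {n} c (v : Vec ℤ n) → #values (Vec.map (ℤ._+_ c) v) ≡ #values v
#values-translate c v = begin
  length (deduplicate ℤ._≟_ (toList (Vec.map (ℤ._+_ c) v)))
    ≡⟨ cong (length ∘ deduplicate ℤ._≟_) (VecP.toList-map (ℤ._+_ c) v) ⟩
  length (deduplicate ℤ._≟_ (map (ℤ._+_ c) (toList v)))
    ≡⟨ cong length (deduplicate-map ℤ._≟_ ℤ._≟_ (∙-cancelˡ c _ _) (toList v)) ⟩
  length (map (ℤ._+_ c) (deduplicate ℤ._≟_ (toList v)))
    ≡⟨ ListP.length-map (ℤ._+_ c) (deduplicate ℤ._≟_ (toList v)) ⟩
  #values v ∎
  where open ≡-Reasoning

#values-∷ : ∀ {n} x (v : Vec ℤ n) → #values (x ∷ v) ℕ.≤ suc (#values v)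
#values-∷ x v = s≤s (ListP.length-filter (¬? ∘ (x ℤ.≟_)) (deduplicate ℤ._≟_ (toList v)))

#values-∷-head : ∀ {n} x (v : Vec ℤ (suc n)) → head v ≡ x → #values (x ∷ v) ≡ #values v
#values-∷-head x (.x ∷ v) refl = cong length (deduplicate-∷-∷ ℤ._≟_ x (toList v))

totalRange-translate : ∀ {n} c (vs : List (Vec ℤ n)) → totalRange (map (Vec.map (ℤ._+_ c)) vs) ≡ totalRange vs
totalRange-translate c vs = cong sum (trans (sym (ListP.map-∘ vs)) (ListP.map-cong (#values-translate c) vs))

totalRange-map-∷ : ∀ {n} x (vs : List (Vec ℤ n)) → totalRange (map (x ∷_) vs) ℕ.≤ totalRange vs ℕ.+ length vs
totalRange-map-∷ x []       = z≤n
totalRange-map-∷ x (v ∷ vs) = begin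
  #values (x ∷ v) ℕ.+ totalRange (map (x ∷_) vs)     ≤⟨ ℕP.+-mono-≤ (#values-∷ x v) (totalRange-map-∷ x vs) ⟩
  suc (#values v) ℕ.+ (totalRange vs ℕ.+ length vs)  ≡⟨ regroup (#values v) (totalRange vs) (length vs) ⟩
  (#values v ℕ.+ totalRange vs) ℕ.+ suc (length vs)  ∎
  where
  open ℕP.≤-Reasoning
  regroup : ∀ a b c → suc a ℕ.+ (b ℕ.+ c) ≡ (a ℕ.+ b) ℕ.+ suc c
  regroup = ℕ-Solver.solve-∀

totalRange-map-∷-head : ∀ {n} x (vs : List (Vec ℤ (suc n))) → All.All (λ v → head v ≡ x) vs →
                        totalRange (map (x ∷_) vs) ≡ totalRange vs
totalRange-map-∷-head x []       All.[]         = refl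
totalRange-map-∷-head x (v ∷ vs) (hv All.∷ hvs) =
  cong₂ ℕ._+_ (#values-∷-head x v hv) (totalRange-map-∷-head x vs hvs)

totalRange-walks : ∀ k a → totalRange (walks k a) ≡ totalRange (walks k 0ℤ)
totalRange-walks k a = begin
  totalRange (walks k a)                             ≡⟨ cong (totalRange ∘ walks k) (ℤP.+-identityʳ a) ⟨
  totalRange (walks k (a ℤ.+ 0ℤ))                    ≡⟨ cong totalRange (walks-translate k a 0ℤ) ⟨
  totalRange (map (Vec.map (ℤ._+_ a)) (walks k 0ℤ))  ≡⟨ totalRange-translate a (walks k 0ℤ) ⟩
  totalRange (walks k 0ℤ)                            ∎
  where open ≡-Reasoning

totalRange-walks-suc : ∀ k → totalRange (walks (suc k) 0ℤ) ℕ.≤ 3 ℕ.* totalRange (walks k 0ℤ) ℕ.+ 2 ℕ.* 3 ^ k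
totalRange-walks-suc k = begin
  totalRange (walks (suc k) 0ℤ)
    ≡⟨ sum-map-concatMap #values (walksWithFirstStep k 0ℤ) unitSteps ⟩
  totalRange (block -1ℤ) ℕ.+ (totalRange (block 0ℤ) ℕ.+ (totalRange (block 1ℤ) ℕ.+ 0))
    ≤⟨ ℕP.+-mono-≤ (moved -1ℤ) (ℕP.+-mono-≤ (ℕP.≤-reflexive stayed) (ℕP.+-monoˡ-≤ 0 (moved 1ℤ))) ⟩
  (R ℕ.+ N) ℕ.+ (R ℕ.+ ((R ℕ.+ N) ℕ.+ 0))
    ≡⟨ regroup R N ⟩
  3 ℕ.* R ℕ.+ 2 ℕ.* N ∎
  where
  open ℕP.≤-Reasoning
  block : ℤ → List (Vec ℤ (suc (suc k)))
  block = walksWithFirstStep k 0ℤ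
  R N : ℕ
  R = totalRange (walks k 0ℤ)
  N = 3 ^ k
  moved : ∀ d → totalRange (block d) ℕ.≤ R ℕ.+ N
  moved d = begin
    totalRange (block d)                             ≤⟨ totalRange-map-∷ 0ℤ (walks k d′) ⟩
    totalRange (walks k d′) ℕ.+ length (walks k d′)  ≡⟨ cong₂ ℕ._+_ (totalRange-walks k d′) (length-walks k d′) ⟩
    R ℕ.+ N                                          ∎
    where
    d′ : ℤ
    d′ = 0ℤ ℤ.+ d
  stayed : totalRange (block 0ℤ) ≡ R
  stayed = totalRange-map-∷-head 0ℤ (walks k 0ℤ) (All.tabulate (proj₁ ∘ ∈-walks⁻ k))
  regroup : ∀ r m → (r ℕ.+ m) ℕ.+ (r ℕ.+ ((r ℕ.+ m) ℕ.+ 0)) ≡ 3 ℕ.* r ℕ.+ 2 ℕ.* m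
  regroup = ℕ-Solver.solve-∀

lipschitz? : ∀ G → Decidable (T ∘ isLipschitz₁ G)
lipschitz? G f = T? (isLipschitz₁ G f)

∈-L₁⁻ : ∀ G {f : Map G} → f ∈ L₁ G → T (isLipschitz₁ G f)
∈-L₁⁻ G = proj₂ ∘ ∈-filter⁻ (lipschitz? G) {xs = allVecs (window (n G)) (n G)}

∈-L₁⁺ : ∀ G {f : Map G} → VecAll.All (_∈ window (n G)) f → T (isLipschitz₁ G f) → f ∈ L₁ G
∈-L₁⁺ G = ∈-filter⁺ (lipschitz? G) ∘ ∈-allVecs⁺

L₁-unique : ∀ G → Unique (L₁ G)
L₁-unique G = UniqueP.filter⁺ (lipschitz? G) (allVecs-unique (n G) (window-unique (n G)))

∈-L₁-path⁻ : ∀ k {f : Vec ℤ (suc k)} → f ∈ L₁ P[1+ k ] → f ∈ walks k 0ℤ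
∈-L₁-path⁻ k {x ∷ f} f∈ with Equivalence.to (T-isLipschitz₁ P[1+ k ] (x ∷ f)) (∈-L₁⁻ P[1+ k ] f∈)
... | refl , L = ∈-walks⁺ k (Lipschitz⇒IsWalk (x ∷ f) L)

∈-L₁-path⁺ : ∀ k {f : Vec ℤ (suc k)} → f ∈ walks k 0ℤ → f ∈ L₁ P[1+ k ]
∈-L₁-path⁺ k {x ∷ f} f∈ with ∈-walks⁻ k f∈
... | refl , walk =
  ∈-L₁⁺ P[1+ k ] in-window (Equivalence.from (T-isLipschitz₁ P[1+ k ] (x ∷ f)) (refl , IsWalk⇒Lipschitz (x ∷ f) walk))
  where
  in-window : VecAll.All (_∈ window (suc k)) (x ∷ f)
  in-window = VecAll.map (λ {z} ∣z∣≤k → ∈-window⁺ z (ℕP.m≤n⇒m≤1+n ∣z∣≤k)) (IsWalk⇒bounded (x ∷ f) walk)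

L₁-path↭walks : ∀ k → L₁ P[1+ k ] ↭ walks k 0ℤ
L₁-path↭walks k =
  ∼bag⇒↭ (unique∧set⇒bag (L₁-unique P[1+ k ]) (walks-unique k 0ℤ) (mk⇔ (∈-L₁-path⁻ k) (∈-L₁-path⁺ k)))

length-L₁-path : ∀ k → length (L₁ P[1+ k ]) ≡ 3 ^ k
length-L₁-path k = trans (↭P.↭-length (L₁-path↭walks k)) (length-walks k 0ℤ)

totalRange-L₁-path : ∀ k → totalRange (L₁ P[1+ k ]) ≡ totalRange (walks k 0ℤ)
totalRange-L₁-path k = ℕLP.sum-↭ (↭P.map⁺ #values (L₁-path↭walks k))

totalRange-L₁-path-suc : ∀ k →
  totalRange (L₁ P[1+ suc k ]) ℕ.≤ 3 ℕ.* totalRange (L₁ P[1+ k ]) ℕ.+ 2 ℕ.* 3 ^ k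
totalRange-L₁-path-suc k = subst₂ ℕ._≤_ (sym (totalRange-L₁-path (suc k)))
  (cong (λ r → 3 ℕ.* r ℕ.+ 2 ℕ.* 3 ^ k) (sym (totalRange-L₁-path k))) (totalRange-walks-suc k)

avg₁≡ : ∀ G {c} → length (L₁ G) ≡ suc c → avg₁ G ≡ + totalRange (L₁ G) / suc c
avg₁≡ G eq with length (L₁ G)
avg₁≡ G refl | _ = refl

m/3d-n/d≤2/3 : ∀ {m n c} → m ℕ.≤ 3 ℕ.* n ℕ.+ 2 ℕ.* suc c → + m / (3 ℕ.* suc c) - + n / suc c ≤ + 2 / 3
m/3d-n/d≤2/3 {m} {n} {c} m≤ = toℚᵘ-cancel-≤ (ℚᵘP.≤-respˡ-≃ (ℚᵘP.≃-sym toℚᵘ-lhs) (*≤* cross))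
  where
  d : ℕ
  d = suc c
  p q : ℚᵘ
  p = mkℚᵘ (+ m) (ℕ.pred (3 ℕ.* d))
  q = mkℚᵘ (+ n) c
  toℚᵘ-lhs : ℚ.toℚᵘ (+ m / (3 ℕ.* d) - + n / d) ≃ p ℚᵘ.- q
  toℚᵘ-lhs = ℚᵘP.≃-trans (toℚᵘ-homo-+ (ℚ.fromℚᵘ p) (ℚ.- ℚ.fromℚᵘ q))
    (ℚᵘP.+-cong (toℚᵘ-fromℚᵘ p) (ℚᵘP.≃-trans (toℚᵘ-homo‿- (ℚ.fromℚᵘ q)) (ℚᵘP.-‿cong (toℚᵘ-fromℚᵘ q))))
  M N D : ℤ
  M = + m
  N = + n
  D = + d
  M≤ : M ℤ.≤ + 3 ℤ.* N ℤ.+ + 2 ℤ.* D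
  M≤ = subst (M ℤ.≤_) (trans (ℤP.pos-+ (3 ℕ.* n) (2 ℕ.* d)) (cong₂ ℤ._+_ (ℤP.pos-* 3 n) (ℤP.pos-* 2 d)))
             (ℤ.+≤+ m≤)
  cross : (M ℤ.* D ℤ.+ ℤ.- N ℤ.* + (3 ℕ.* d)) ℤ.* + 3 ℤ.≤ + 2 ℤ.* + (3 ℕ.* d ℕ.* d)
  cross = begin
    (M ℤ.* D ℤ.+ ℤ.- N ℤ.* + (3 ℕ.* d)) ℤ.* + 3
      ≡⟨ cong (λ t → (M ℤ.* D ℤ.+ ℤ.- N ℤ.* t) ℤ.* + 3) (ℤP.pos-* 3 d) ⟩
    (M ℤ.* D ℤ.+ ℤ.- N ℤ.* (+ 3 ℤ.* D)) ℤ.* + 3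
      ≤⟨ ℤP.*-monoʳ-≤-nonNeg (+ 3) (ℤP.+-monoˡ-≤ _ (ℤP.*-monoʳ-≤-nonNeg D M≤)) ⟩
    ((+ 3 ℤ.* N ℤ.+ + 2 ℤ.* D) ℤ.* D ℤ.+ ℤ.- N ℤ.* (+ 3 ℤ.* D)) ℤ.* + 3
      ≡⟨ expand N D ⟩
    + 2 ℤ.* (+ 3 ℤ.* D ℤ.* D)
      ≡⟨ cong (λ t → + 2 ℤ.* (t ℤ.* D)) (ℤP.pos-* 3 d) ⟨
    + 2 ℤ.* (+ (3 ℕ.* d) ℤ.* D)
      ≡⟨ cong (+ 2 ℤ.*_) (ℤP.pos-* (3 ℕ.* d) d) ⟨
    + 2 ℤ.* + (3 ℕ.* d ℕ.* d) ∎
    where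
    open ℤP.≤-Reasoning
    expand : ∀ N D → ((+ 3 ℤ.* N ℤ.+ + 2 ℤ.* D) ℤ.* D ℤ.+ ℤ.- N ℤ.* (+ 3 ℤ.* D)) ℤ.* + 3
                     ≡ + 2 ℤ.* (+ 3 ℤ.* D ℤ.* D)
    expand = ℤ-Solver.solve-∀

lemma1 : ∀ k → avg₁ P[1+ suc k ] - avg₁ P[1+ k ] ≤ (+ 2) / 3
lemma1 k =
  subst₂ (λ a b → a - b ≤ + 2 / 3) (sym (avg₁≡ P[1+ suc k ] |L₁[k+1]|)) (sym (avg₁≡ P[1+ k ] |L₁[k]|))
    (m/3d-n/d≤2/3 {n = totalRange (L₁ P[1+ k ])} {c = c} growth)
  where
  c : ℕ
  c = ℕ.pred (3 ^ k)
  3^k≡1+c : 3 ^ k ≡ suc c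
  3^k≡1+c = sym (ℕP.suc-pred (3 ^ k) {{ℕP.m^n≢0 3 k}})
  |L₁[k]| : length (L₁ P[1+ k ]) ≡ suc c
  |L₁[k]| = trans (length-L₁-path k) 3^k≡1+c
  |L₁[k+1]| : length (L₁ P[1+ suc k ]) ≡ 3 ℕ.* suc c
  |L₁[k+1]| = trans (length-L₁-path (suc k)) (cong (3 ℕ.*_) 3^k≡1+c)
  growth : totalRange (L₁ P[1+ suc k ]) ℕ.≤ 3 ℕ.* totalRange (L₁ P[1+ k ]) ℕ.+ 2 ℕ.* suc c
  growth = subst (λ N → totalRange (L₁ P[1+ suc k ]) ℕ.≤ 3 ℕ.* totalRange (L₁ P[1+ k ]) ℕ.+ 2 ℕ.* N)
                 3^k≡1+c (totalRange-L₁-path-suc k)
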